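{- There is $r_0$ such that the following holds for every integer $r\ge r_0$. Let $k=2^r-(2^r\bmod r^2)$ (so $k/r^2$ is an integer). Suppose that $\pi_1,\dots,\pi_{2r^2+r}\in[k]^{k/r^2}$ are words such that each $\pi_i$ is a permutation of some (possibly different for different $i$) $(k/r^2)$-element subset of $[k]$. Then there is a triple $i<j<\ell$ with \[ \mathrm{LCS}(\pi_i,\pi_j)\,\mathrm{LCS}(\pi_i,\pi_\ell)\,\mathrm{LCS}(\pi_j,\pi_\ell)\geq k/r^8. \]
   Context: A permutation of a set $\Sigma\subset[k]$ is a word of length $|\Sigma|$ in which each symbol of $\Sigma$ occurs exactly once. For words $w_1,w_2$, $\mathrm{LCS}(w_1,w_2)$ is the length of the longest common subsequence of $w_1$ and $w_2$. -}

module Defs where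

open import Data.Nat using (ℕ; zero; suc; _+_; _*_; _∸_; _^_; _⊔_; NonZero; _/_; _%_)
open import Data.Nat.Properties using (m*n≢0)
open import Data.Fin using (Fin)
open import Data.Fin.Properties using (_≟_)
open import Data.List using (List; []; _∷_; map; _++_; length; filter; foldr)
open import Data.List.Properties using (≡-dec)
import Data.List.Membership.DecPropositional as DecMem

subsequences : {A : Set} → List A → List (List A)
subsequences []       = [] ∷ []
subsequences (x ∷ xs) = let ss = subsequences xs in ss ++ map (x ∷_) ss

maxList : List ℕ → ℕ
maxList = foldr _⊔_ 0

LCS : {k : ℕ} → List (Fin k) → List (Fin k) → ℕ
LCS {k} w₁ w₂ = maxList (map length (filter (λ s → s ∈? subsequences w₂) (subsequences w₁)))
  where open DecMem (≡-dec (_≟_ {k})) using (_∈?_)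

kOf : (r : ℕ) → .{{NonZero r}} → ℕ
kOf r = 2 ^ r ∸ _%_ (2 ^ r) (r * r) {{m*n≢0 r r}}

lenOf : (r : ℕ) → .{{NonZero r}} → ℕ
lenOf r = _/_ (kOf r) (r * r) {{m*n≢0 r r}}

-- Let the m = 2r² + r words have n = k/r² distinct letters each. A letter lying in d of the words
-- lies in at least d − 2 increasing triples of them (the first two such words and any later one),
-- so summing over letters, the triples i < j < l share at least Σ (d − 2) = mn − 2k = rn common
-- letters in total, and some triple shares at least rn/m³ of them. For that triple (a, b, c), send
-- a common letter x to the LCS lengths of the three pairs of prefixes ending just before x. This
-- is injective: two of the three words put any two common letters in the same order, and along
-- that pair the value strictly increases. Hence the number of common letters is at most the
-- product of the three LCS, and m³ ≤ r⁷ for r ≥ 27 turns rn ≤ m³·LCS³ into k ≤ r⁸·LCS³.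
module Submission where

open import Defs
open import Data.Nat using (ℕ; zero; suc; _+_; _*_; _^_; _∸_; _≤_; _⊔_; z≤n; s≤s; NonZero; _/_; _%_)
import Data.Nat as ℕ
open import Data.Nat.Properties hiding (_≟_; suc-injective)
open import Data.Nat.DivMod using (m≡m%n+[m/n]*n; m*n/n≡m)
open import Data.Nat.Tactic.RingSolver using (solve-∀)
open import Data.Fin using (Fin; zero; suc; _<_; punchOut; fromℕ<; combine)
open import Data.Fin.Properties
  using (_≟_; suc-injective; punchOut-injective; fromℕ<-injective; combine-injective)
open import Data.Vec using (Vec; []; _∷_; lookup; toList)
open import Data.Vec.Properties using (length-toList)
open import Data.Vec.Functional using (Vector; tail)
open import Data.List using (List; []; _∷_; [_]; _++_; length; map; filter; tabulate)
open import Data.List.Properties using (≡-dec; length-++)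
open import Data.List.Membership.Propositional using (_∈_)
open import Data.List.Membership.Propositional.Properties
  using (∈-++⁺ˡ; ∈-++⁺ʳ; ∈-++⁻; ∈-map⁺; ∈-map⁻; ∈-filter⁺; ∈-filter⁻; foldr-selective)
import Data.List.Membership.DecPropositional as DecMembership
open import Data.List.Relation.Unary.Any using (here; there)
import Data.List.Relation.Unary.Any as Any
import Data.List.Relation.Unary.All as All
open import Data.List.Relation.Unary.AllPairs using ([]; _∷_)
open import Data.List.Relation.Unary.Unique.Propositional using (Unique)
open import Data.List.Relation.Unary.Unique.Propositional.Properties using (tabulate⁺)
open import Data.List.Relation.Binary.Sublist.Propositional
  using (_⊆_; []; _∷_; _∷ʳ_; ⊆-trans; minimum)
open import Data.List.Relation.Binary.Sublist.Propositional.Properties using (++⁺)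
open import Data.Product using (∃-syntax; _×_; _,_)
open import Data.Sum using (_⊎_; inj₁; inj₂)
import Data.Sum as Sum
open import Data.Bool using (if_then_else_)
open import Data.Empty using (⊥; ⊥-elim)
open import Function using (_∘_)
open import Function.Definitions using (Injective)
open import Relation.Nullary using (Dec; yes; no; does; contradiction)
open import Relation.Nullary.Decidable using (_⊎-dec_; _×-dec_)
open import Relation.Unary using (Pred; Decidable)
open import Relation.Binary.Definitions using (DecidableEquality)
open import Relation.Binary.PropositionalEquality
  using (_≡_; _≢_; refl; sym; trans; cong; cong₂; subst; subst₂; module ≡-Reasoning)
open import Algebra.Properties.Semiring.Sum +-*-semiring
  using (sum; sum-syntax; sum-replicate-zero; sum-cong-≗; ∑-distrib-+; ∑-comm)

-- Through does rather than yes/no, so that 𝟙 computes through map′ (e.g. 𝟙 (suc x ≟ suc a) = 𝟙 (x ≟ a)).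
𝟙 : ∀ {p} {P : Set p} → Dec P → ℕ
𝟙 d = if does d then 1 else 0

𝟙≤1 : ∀ {p} {P : Set p} (p? : Dec P) → 𝟙 p? ≤ 1
𝟙≤1 (yes _) = s≤s z≤n
𝟙≤1 (no _)  = z≤n

𝟙-⊎ : ∀ {p q} {P : Set p} {Q : Set q} (p? : Dec P) (q? : Dec Q) →
      (P → Q → ⊥) → 𝟙 (p? ⊎-dec q?) ≡ 𝟙 p? + 𝟙 q?
𝟙-⊎ (yes p) (yes q) ¬p×q = ⊥-elim (¬p×q p q)
𝟙-⊎ (yes _) (no _)  _    = refl
𝟙-⊎ (no _)  _       _    = refl

𝟙-× : ∀ {p q} {P : Set p} {Q : Set q} (p? : Dec P) (q? : Dec Q) →
      𝟙 (p? ×-dec q?) ≡ 𝟙 p? * 𝟙 q?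
𝟙-× (yes _) (yes _) = refl
𝟙-× (yes _) (no _)  = refl
𝟙-× (no _)  _       = refl

∑-mono-≤ : ∀ {n} {f g : Vector ℕ n} → (∀ i → f i ≤ g i) → sum f ≤ sum g
∑-mono-≤ {zero}  f≤g = z≤n
∑-mono-≤ {suc n} f≤g = +-mono-≤ (f≤g zero) (∑-mono-≤ (f≤g ∘ suc))

∑-const : ∀ n c → ∑[ i < n ] c ≡ n * c
∑-const zero    c = refl
∑-const (suc n) c = cong (c +_) (∑-const n c)

∑-≤-max : ∀ {n} (f : Vector ℕ (suc n)) → ∃[ i ] sum f ≤ suc n * f i
∑-≤-max {zero}  f = zero , ≤-refl
∑-≤-max {suc n} f with ∑-≤-max (tail f)
... | i , ∑tail≤ with f zero ≤? f (suc i)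
...   | yes f₀≤fᵢ = suc i , +-mono-≤ f₀≤fᵢ ∑tail≤
...   | no  f₀≰fᵢ = zero , +-monoʳ-≤ (f zero)
                      (≤-trans ∑tail≤ (*-monoʳ-≤ (suc n) (<⇒≤ (≰⇒> f₀≰fᵢ))))

∑-𝟙-≟ : ∀ {k} (a : Fin k) → ∑[ x < k ] 𝟙 (x ≟ a) ≡ 1
∑-𝟙-≟ {suc k} zero    = cong suc (sum-replicate-zero k)
∑-𝟙-≟ {suc k} (suc a) = ∑-𝟙-≟ a

∑-𝟙-≤-injection : ∀ {p k N} {P : Pred (Fin k) p} (P? : Decidable P)
                  (g : ∀ x → P x → Fin N) →
                  (∀ {x y} p q → g x p ≡ g y q → x ≡ y) →
                  ∑[ x < k ] 𝟙 (P? x) ≤ N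
∑-𝟙-≤-injection {k = zero} P? g g-inj = z≤n
∑-𝟙-≤-injection {k = suc k} P? g g-inj with P? zero
... | no _ = ∑-𝟙-≤-injection (P? ∘ suc) (g ∘ suc) (λ p q → suc-injective ∘ g-inj p q)
∑-𝟙-≤-injection {k = suc k} {zero} P? g g-inj | yes p₀ with g zero p₀
... | ()
∑-𝟙-≤-injection {k = suc k} {suc N} {P} P? g g-inj | yes p₀ =
  s≤s (∑-𝟙-≤-injection (P? ∘ suc) (λ x p → punchOut (g₀≢ p)) punched-injective)
  where
    g₀≢ : ∀ {x} (p : P (suc x)) → g zero p₀ ≢ g (suc x) p
    g₀≢ p g₀≡ with () ← g-inj p₀ p g₀≡
    punched-injective : ∀ {x y} p q → punchOut (g₀≢ {x} p) ≡ punchOut (g₀≢ {y} q) → x ≡ y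
    punched-injective p q = suc-injective ∘ g-inj p q ∘ punchOut-injective (g₀≢ p) (g₀≢ q)

sumPairs : ∀ {m} → (Fin m → Fin m → ℕ) → ℕ
sumPairs {zero}  f = 0
sumPairs {suc m} f = ∑[ l < m ] f zero (suc l) + sumPairs (λ j l → f (suc j) (suc l))

sumTriples : ∀ {m} → (Fin m → Fin m → Fin m → ℕ) → ℕ
sumTriples {zero}  f = 0
sumTriples {suc m} f = sumPairs (λ j l → f zero (suc j) (suc l))
                     + sumTriples (λ i j l → f (suc i) (suc j) (suc l))

sumPairs-cong : ∀ {m} {f g : Fin m → Fin m → ℕ} → (∀ j l → f j l ≡ g j l) →
                sumPairs f ≡ sumPairs g
sumPairs-cong {zero}  f≗g = refl
sumPairs-cong {suc m} f≗g =
  cong₂ _+_ (sum-cong-≗ (λ l → f≗g zero (suc l))) (sumPairs-cong (λ j l → f≗g (suc j) (suc l)))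

∑-sumPairs : ∀ {k m} (F : Fin k → Fin m → Fin m → ℕ) →
             ∑[ x < k ] sumPairs (F x) ≡ sumPairs (λ j l → ∑[ x < k ] F x j l)
∑-sumPairs {k} {zero}  F = sum-replicate-zero k
∑-sumPairs {k} {suc m} F =
  trans (∑-distrib-+ (λ x → ∑[ l < m ] F x zero (suc l))
                     (λ x → sumPairs (λ j l → F x (suc j) (suc l))))
        (cong₂ _+_ (∑-comm (λ x l → F x zero (suc l)))
                   (∑-sumPairs (λ x j l → F x (suc j) (suc l))))

∑-sumTriples : ∀ {k m} (F : Fin k → Fin m → Fin m → Fin m → ℕ) →
               ∑[ x < k ] sumTriples (F x) ≡ sumTriples (λ i j l → ∑[ x < k ] F x i j l)
∑-sumTriples {k} {zero}  F = sum-replicate-zero k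
∑-sumTriples {k} {suc m} F =
  trans (∑-distrib-+ (λ x → sumPairs (λ j l → F x zero (suc j) (suc l)))
                     (λ x → sumTriples (λ i j l → F x (suc i) (suc j) (suc l))))
        (cong₂ _+_ (∑-sumPairs (λ x j l → F x zero (suc j) (suc l)))
                   (∑-sumTriples (λ x i j l → F x (suc i) (suc j) (suc l))))

sum≤sumPairs+1 : ∀ {m} (e : Vector ℕ m) → (∀ i → e i ≤ 1) →
                 sum e ≤ sumPairs (λ j l → e j * e l) + 1
sum≤sumPairs+1 {zero}  e e≤1 = z≤n
sum≤sumPairs+1 {suc m} e e≤1 with e zero | e≤1 zero
... | 0 | _ = ≤-trans (sum≤sumPairs+1 (tail e) (e≤1 ∘ suc)) (+-monoˡ-≤ 1 (m≤n+m _ _))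
... | 1 | _ = begin
  1 + sum (tail e)                     ≡⟨ +-comm 1 _ ⟩
  sum (tail e) + 1                     ≡⟨ cong (_+ 1) (sum-cong-≗ (λ l → sym (*-identityˡ (e (suc l))))) ⟩
  ∑[ l < m ] (1 * e (suc l)) + 1       ≤⟨ +-monoˡ-≤ 1 (m≤m+n _ _) ⟩
  ∑[ l < m ] (1 * e (suc l)) + sumPairs (λ j l → e (suc j) * e (suc l)) + 1 ∎
  where open ≤-Reasoning
... | suc (suc _) | s≤s ()

sum≤sumTriples+2 : ∀ {m} (e : Vector ℕ m) → (∀ i → e i ≤ 1) →
                   sum e ≤ sumTriples (λ i j l → e i * (e j * e l)) + 2
sum≤sumTriples+2 {zero}  e e≤1 = z≤n
sum≤sumTriples+2 {suc m} e e≤1 with e zero | e≤1 zero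
... | 0 | _ = ≤-trans (sum≤sumTriples+2 (tail e) (e≤1 ∘ suc)) (+-monoˡ-≤ 2 (m≤n+m _ _))
... | 1 | _ = begin
  1 + sum (tail e)
    ≤⟨ +-monoʳ-≤ 1 (sum≤sumPairs+1 (tail e) (e≤1 ∘ suc)) ⟩
  1 + (sumPairs (λ j l → e (suc j) * e (suc l)) + 1)
    ≡⟨ +-suc _ 1 ⟨
  sumPairs (λ j l → e (suc j) * e (suc l)) + 2
    ≡⟨ cong (_+ 2) (sumPairs-cong (λ j l → sym (*-identityˡ (e (suc j) * e (suc l))))) ⟩
  sumPairs (λ j l → 1 * (e (suc j) * e (suc l))) + 2
    ≤⟨ +-monoˡ-≤ 2 (m≤m+n _ _) ⟩
  sumPairs (λ j l → 1 * (e (suc j) * e (suc l)))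
    + sumTriples (λ i j l → e (suc i) * (e (suc j) * e (suc l))) + 2 ∎
  where open ≤-Reasoning
... | suc (suc _) | s≤s ()

private
  +-≤-*-⊔ : ∀ s t x y {a b} → a ≤ s * x → b ≤ t * y → a + b ≤ (s + t) * (x ⊔ y)
  +-≤-*-⊔ s t x y {a} {b} a≤sx b≤ty = begin
    a + b                     ≤⟨ +-mono-≤ (≤-trans a≤sx (*-monoʳ-≤ s (m≤m⊔n x y)))
                                          (≤-trans b≤ty (*-monoʳ-≤ t (m≤n⊔m x y))) ⟩
    s * (x ⊔ y) + t * (x ⊔ y) ≡⟨ *-distribʳ-+ (x ⊔ y) s t ⟨
    (s + t) * (x ⊔ y)         ∎
    where open ≤-Reasoning

  +-≤-*-either : ∀ s t x y {a b} → a ≤ s * x → b ≤ t * y →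
                 a + b ≤ (s + t) * x ⊎ a + b ≤ (s + t) * y
  +-≤-*-either s t x y {a} {b} a≤sx b≤ty with ⊔-sel x y
  ... | inj₁ x⊔y≡x = inj₁ (subst (λ z → a + b ≤ (s + t) * z) x⊔y≡x (+-≤-*-⊔ s t x y a≤sx b≤ty))
  ... | inj₂ x⊔y≡y = inj₂ (subst (λ z → a + b ≤ (s + t) * z) x⊔y≡y (+-≤-*-⊔ s t x y a≤sx b≤ty))

  n+n²≤[1+n]² : ∀ n → n + n * n ≤ suc n * suc n
  n+n²≤[1+n]² n = subst (n + n * n ≤_) (expand n) (m≤m+n _ _)
    where
      expand : ∀ n → n + n * n + suc n ≡ suc n * suc n
      expand = solve-∀

  n²+n³≤[1+n]³ : ∀ n → n * n + n * n * n ≤ suc n * suc n * suc n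
  n²+n³≤[1+n]³ n = subst (n * n + n * n * n ≤_) (expand n) (m≤m+n _ _)
    where
      expand : ∀ n → n * n + n * n * n + (suc n + 2 * (n * suc n)) ≡ suc n * suc n * suc n
      expand = solve-∀

sumPairs-≤-max : ∀ {m} (g : Fin (2 + m) → Fin (2 + m) → ℕ) →
                 ∃[ j ] ∃[ l ] (j < l × sumPairs g ≤ (2 + m) * (2 + m) * g j l)
sumPairs-≤-max {zero} g with ∑-≤-max (λ l → g zero (suc l))
... | l₀ , first≤ = zero , suc l₀ , s≤s z≤n ,
  ≤-trans (≤-reflexive (+-identityʳ _)) (≤-trans first≤ (*-monoˡ-≤ (g zero (suc l₀)) {1} {4} (s≤s z≤n)))
sumPairs-≤-max {suc m} g
  with ∑-≤-max (λ l → g zero (suc l)) | sumPairs-≤-max (λ j l → g (suc j) (suc l))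
... | l₀ , first≤ | j , l , j<l , rest≤
  with +-≤-*-either (2 + m) ((2 + m) * (2 + m)) (g zero (suc l₀)) (g (suc j) (suc l)) first≤ rest≤
...   | inj₁ ≤first = zero , suc l₀ , s≤s z≤n ,
                      ≤-trans ≤first (*-monoˡ-≤ (g zero (suc l₀)) (n+n²≤[1+n]² (2 + m)))
...   | inj₂ ≤rest  = suc j , suc l , s≤s j<l ,
                      ≤-trans ≤rest (*-monoˡ-≤ (g (suc j) (suc l)) (n+n²≤[1+n]² (2 + m)))

sumTriples-≤-max : ∀ {m} (f : Fin (3 + m) → Fin (3 + m) → Fin (3 + m) → ℕ) →
                   ∃[ i ] ∃[ j ] ∃[ l ] (i < j × j < l ×
                     sumTriples f ≤ (3 + m) * (3 + m) * (3 + m) * f i j l)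
sumTriples-≤-max {zero} f with sumPairs-≤-max (λ j l → f zero (suc j) (suc l))
... | j , l , j<l , pairs≤ = zero , suc j , suc l , s≤s z≤n , s≤s j<l ,
  ≤-trans (≤-reflexive (+-identityʳ _))
          (≤-trans pairs≤ (*-monoˡ-≤ (f zero (suc j) (suc l)) {4} {27} (s≤s (s≤s (s≤s (s≤s z≤n))))))
sumTriples-≤-max {suc m} f
  with sumPairs-≤-max (λ j l → f zero (suc j) (suc l))
     | sumTriples-≤-max (λ i j l → f (suc i) (suc j) (suc l))
... | j₀ , l₀ , j₀<l₀ , pairs≤ | i , j , l , i<j , j<l , rest≤
  with +-≤-*-either ((3 + m) * (3 + m)) ((3 + m) * (3 + m) * (3 + m))
                    (f zero (suc j₀) (suc l₀)) (f (suc i) (suc j) (suc l)) pairs≤ rest≤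
...   | inj₁ ≤pairs = zero , suc j₀ , suc l₀ , s≤s z≤n , s≤s j₀<l₀ ,
                      ≤-trans ≤pairs (*-monoˡ-≤ (f zero (suc j₀) (suc l₀)) (n²+n³≤[1+n]³ (3 + m)))
...   | inj₂ ≤rest  = suc i , suc j , suc l , s≤s i<j , s≤s j<l ,
                      ≤-trans ≤rest (*-monoˡ-≤ (f (suc i) (suc j) (suc l)) (n²+n³≤[1+n]³ (3 + m)))

module _ {A : Set} where

  ⊆⇒∈-subsequences : ∀ {s w : List A} → s ⊆ w → s ∈ subsequences w
  ⊆⇒∈-subsequences []         = here refl
  ⊆⇒∈-subsequences (y ∷ʳ s⊆w) = ∈-++⁺ˡ (⊆⇒∈-subsequences s⊆w)
  ⊆⇒∈-subsequences {w = x ∷ w} (refl ∷ s⊆w) =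
    ∈-++⁺ʳ (subsequences w) (∈-map⁺ (x ∷_) (⊆⇒∈-subsequences s⊆w))

  ∈-subsequences⇒⊆ : ∀ {s} (w : List A) → s ∈ subsequences w → s ⊆ w
  ∈-subsequences⇒⊆ []      (here refl) = []
  ∈-subsequences⇒⊆ (x ∷ w) s∈ with ∈-++⁻ (subsequences w) s∈
  ... | inj₁ s∈ʷ = x ∷ʳ ∈-subsequences⇒⊆ w s∈ʷ
  ... | inj₂ s∈ˣʷ with ∈-map⁻ (x ∷_) s∈ˣʷ
  ...   | _ , s∈ʷ , refl = refl ∷ ∈-subsequences⇒⊆ w s∈ʷ

∈⇒≤maxList : ∀ {n} {ns : List ℕ} → n ∈ ns → n ≤ maxList ns
∈⇒≤maxList {ns = n ∷ ns} (here refl) = m≤m⊔n n (maxList ns)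
∈⇒≤maxList {ns = m ∷ ns} (there n∈) = ≤-trans (∈⇒≤maxList n∈) (m≤n⊔m m (maxList ns))

module _ {k : ℕ} where
  open DecMembership (≡-dec (_≟_ {k})) using (_∈?_)

  length≤LCS : ∀ {s u v : List (Fin k)} → s ⊆ u → s ⊆ v → length s ≤ LCS u v
  length≤LCS {v = v} s⊆u s⊆v = ∈⇒≤maxList (∈-map⁺ length
    (∈-filter⁺ (λ s → s ∈? subsequences v) (⊆⇒∈-subsequences s⊆u) (⊆⇒∈-subsequences s⊆v)))

  LCS-witness : ∀ (u v : List (Fin k)) → ∃[ s ] (s ⊆ u × s ⊆ v × length s ≡ LCS u v)
  LCS-witness u v
    with foldr-selective ⊔-sel 0 (map length (filter (λ s → s ∈? subsequences v) (subsequences u)))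
  ... | inj₁ LCS≡0 = [] , minimum u , minimum v , sym LCS≡0
  ... | inj₂ LCS∈ with ∈-map⁻ length LCS∈
  ...   | s , s∈ , LCS≡∣s∣ with ∈-filter⁻ (λ s → s ∈? subsequences v) {xs = subsequences u} s∈
  ...     | s∈u , s∈v = s , ∈-subsequences⇒⊆ u s∈u , ∈-subsequences⇒⊆ v s∈v , sym LCS≡∣s∣

  LCS-extend : ∀ {u v u′ v′ : List (Fin k)} (x : Fin k) →
               u ++ [ x ] ⊆ u′ → v ++ [ x ] ⊆ v′ → LCS u v ℕ.< LCS u′ v′
  LCS-extend {u} {v} {u′} {v′} x ux⊆u′ vx⊆v′ with LCS-witness u v
  ... | s , s⊆u , s⊆v , ∣s∣≡LCS =
    subst (_≤ LCS u′ v′) (trans (length-++ s) (trans (+-comm (length s) 1) (cong suc ∣s∣≡LCS)))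
      (length≤LCS (⊆-trans (++⁺ s⊆u (refl ∷ [])) ux⊆u′) (⊆-trans (++⁺ s⊆v (refl ∷ [])) vx⊆v′))

module FirstOccurrence {a} {A : Set a} (_≟_ : DecidableEquality A) where

  before : A → List A → List A
  before x []      = []
  before x (y ∷ w) with x ≟ y
  ... | yes _ = []
  ... | no  _ = y ∷ before x w

  before-++-⊆ : ∀ {x w} → x ∈ w → before x w ++ [ x ] ⊆ w
  before-++-⊆ {x} {y ∷ w} x∈ with x ≟ y
  ... | yes refl = refl ∷ minimum w
  ... | no  x≢y  = refl ∷ before-++-⊆ (Any.tail x≢y x∈)

  before-before : ∀ {x y} w → x ∈ before y w → before x (before y w) ≡ before x w
  before-before {x} {y} (z ∷ w) x∈ with y ≟ z
  ... | no _ with x ≟ z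
  ...   | yes _   = refl
  ...   | no  x≢z = cong (z ∷_) (before-before w (Any.tail x≢z x∈))

  before-total : ∀ {x y w} → x ∈ w → y ∈ w → x ≢ y → x ∈ before y w ⊎ y ∈ before x w
  before-total {x} {y} {z ∷ w} x∈ y∈ x≢y with x ≟ z | y ≟ z
  ... | yes refl | yes refl = contradiction refl x≢y
  ... | yes refl | no  _    = inj₁ (here refl)
  ... | no  _    | yes refl = inj₂ (here refl)
  ... | no  x≢z  | no  y≢z  =
    Sum.map there there (before-total (Any.tail x≢z x∈) (Any.tail y≢z y∈) x≢y)

module _ {k : ℕ} where
  open DecMembership (_≟_ {k}) using (_∈?_)
  open FirstOccurrence (_≟_ {k})

  ∣_∩_∩_∣ : List (Fin k) → List (Fin k) → List (Fin k) → ℕ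
  ∣ a ∩ b ∩ c ∣ = ∑[ x < k ] (𝟙 (x ∈? a) * (𝟙 (x ∈? b) * 𝟙 (x ∈? c)))

  lcsBefore : List (Fin k) → List (Fin k) → Fin k → ℕ
  lcsBefore u v x = LCS (before x u) (before x v)

  lcsBefore<LCS : ∀ {x u v} → x ∈ u → x ∈ v → lcsBefore u v x ℕ.< LCS u v
  lcsBefore<LCS {x} x∈u x∈v = LCS-extend x (before-++-⊆ x∈u) (before-++-⊆ x∈v)

  lcsBefore-< : ∀ {x y} u v → x ∈ before y u → x ∈ before y v →
                lcsBefore u v x ℕ.< lcsBefore u v y
  lcsBefore-< {x} {y} u v x∈u x∈v =
    subst₂ (λ s t → LCS s t ℕ.< lcsBefore u v y) (before-before u x∈u) (before-before v x∈v)
      (lcsBefore<LCS x∈u x∈v)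

  private
    -- Two of a, b, c order x and y alike, and lcsBefore of that pair separates them.
    ordered-collision : ∀ {x y a b c} → x ∈ before y a → x ≢ y →
      x ∈ b → y ∈ b → x ∈ c → y ∈ c →
      lcsBefore a b x ≡ lcsBefore a b y → lcsBefore a c x ≡ lcsBefore a c y →
      lcsBefore b c x ≡ lcsBefore b c y → ⊥
    ordered-collision {a = a} {b} {c} x<ᵃy x≢y x∈b y∈b x∈c y∈c ab≡ ac≡ bc≡
      with before-total x∈b y∈b x≢y
    ... | inj₁ x<ᵇy = <-irrefl ab≡ (lcsBefore-< a b x<ᵃy x<ᵇy)
    ... | inj₂ y<ᵇx with before-total x∈c y∈c x≢y
    ...   | inj₁ x<ᶜy = <-irrefl ac≡ (lcsBefore-< a c x<ᵃy x<ᶜy)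
    ...   | inj₂ y<ᶜx = <-irrefl (sym bc≡) (lcsBefore-< b c y<ᵇx y<ᶜx)

  lcsBefore-injective : ∀ {x y a b c} → x ∈ a × x ∈ b × x ∈ c → y ∈ a × y ∈ b × y ∈ c →
      lcsBefore a b x ≡ lcsBefore a b y → lcsBefore a c x ≡ lcsBefore a c y →
      lcsBefore b c x ≡ lcsBefore b c y → x ≡ y
  lcsBefore-injective {x} {y} {a} {b} {c} (x∈a , x∈b , x∈c) (y∈a , y∈b , y∈c) ab≡ ac≡ bc≡
    with x ≟ y
  ... | yes x≡y = x≡y
  ... | no  x≢y with before-total x∈a y∈a x≢y
  ...   | inj₁ x<ᵃy = ⊥-elim (ordered-collision {a = a} {b} {c} x<ᵃy x≢y
                                 x∈b y∈b x∈c y∈c ab≡ ac≡ bc≡)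
  ...   | inj₂ y<ᵃx = ⊥-elim (ordered-collision {a = a} {b} {c} y<ᵃx (x≢y ∘ sym)
                                 y∈b x∈b y∈c x∈c (sym ab≡) (sym ac≡) (sym bc≡))

  ∣∩∩∣≤LCS³ : ∀ a b c → ∣ a ∩ b ∩ c ∣ ≤ LCS a b * LCS a c * LCS b c
  ∣∩∩∣≤LCS³ a b c = begin
    ∣ a ∩ b ∩ c ∣                ≡⟨ sum-cong-≗ 𝟙-common? ⟨
    ∑[ x < k ] 𝟙 (common? x)     ≤⟨ ∑-𝟙-≤-injection common? signature signature-injective ⟩
    LCS a b * LCS a c * LCS b c  ∎
    where
      open ≤-Reasoning
      common? : Decidable (λ x → x ∈ a × x ∈ b × x ∈ c)
      common? x = x ∈? a ×-dec x ∈? b ×-dec x ∈? c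
      𝟙-common? : ∀ x → 𝟙 (common? x) ≡ 𝟙 (x ∈? a) * (𝟙 (x ∈? b) * 𝟙 (x ∈? c))
      𝟙-common? x = trans (𝟙-× (x ∈? a) (x ∈? b ×-dec x ∈? c))
                          (cong (𝟙 (x ∈? a) *_) (𝟙-× (x ∈? b) (x ∈? c)))
      signature : ∀ x → x ∈ a × x ∈ b × x ∈ c → Fin (LCS a b * LCS a c * LCS b c)
      signature x (x∈a , x∈b , x∈c) =
        combine (combine (fromℕ< (lcsBefore<LCS x∈a x∈b)) (fromℕ< (lcsBefore<LCS x∈a x∈c)))
                (fromℕ< (lcsBefore<LCS x∈b x∈c))
      signature-injective : ∀ {x y} p q → signature x p ≡ signature y q → x ≡ y
      signature-injective p@(x∈a , x∈b , x∈c) q@(y∈a , y∈b , y∈c) σ≡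
        with combine-injective _ _ _ _ σ≡
      ... | ab-ac≡ , bc≡ with combine-injective _ _ _ _ ab-ac≡
      ...   | ab≡ , ac≡ = lcsBefore-injective p q
        (fromℕ<-injective _ _ (lcsBefore<LCS x∈a x∈b) (lcsBefore<LCS y∈a y∈b) ab≡)
        (fromℕ<-injective _ _ (lcsBefore<LCS x∈a x∈c) (lcsBefore<LCS y∈a y∈c) ac≡)
        (fromℕ<-injective _ _ (lcsBefore<LCS x∈b x∈c) (lcsBefore<LCS y∈b y∈c) bc≡)

  ∑-𝟙-∈ : ∀ {w : List (Fin k)} → Unique w → ∑[ x < k ] 𝟙 (x ∈? w) ≡ length w
  ∑-𝟙-∈ {[]}    []               = sum-replicate-zero k
  ∑-𝟙-∈ {a ∷ w} (a∉w ∷ w-unique) = begin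
    ∑[ x < k ] 𝟙 (x ∈? a ∷ w)
      ≡⟨ sum-cong-≗ (λ x → 𝟙-⊎ (x ≟ a) (x ∈? w) (λ x≡a x∈w → All.lookup a∉w x∈w (sym x≡a))) ⟩
    ∑[ x < k ] (𝟙 (x ≟ a) + 𝟙 (x ∈? w))
      ≡⟨ ∑-distrib-+ (λ x → 𝟙 (x ≟ a)) (λ x → 𝟙 (x ∈? w)) ⟩
    ∑[ x < k ] 𝟙 (x ≟ a) + ∑[ x < k ] 𝟙 (x ∈? w)
      ≡⟨ cong₂ _+_ (∑-𝟙-≟ a) (∑-𝟙-∈ w-unique) ⟩
    1 + length w
      ∎
    where open ≡-Reasoning

  rich-triple : ∀ {m} (w : Fin m → List (Fin k)) → (∀ i → Unique (w i)) → 3 ≤ m →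
                ∃[ i ] ∃[ j ] ∃[ l ] (i < j × j < l ×
                  ∑[ i < m ] length (w i) ≤ 2 * k + m * m * m * ∣ w i ∩ w j ∩ w l ∣)
  rich-triple {m} w w-unique (s≤s (s≤s (s≤s _)))
    with sumTriples-≤-max (λ i j l → ∣ w i ∩ w j ∩ w l ∣)
  ... | i , j , l , i<j , j<l , triples≤ = i , j , l , i<j , j<l , (begin
    ∑[ i < m ] length (w i)
      ≡⟨ sum-cong-≗ (λ i → ∑-𝟙-∈ (w-unique i)) ⟨
    ∑[ i < m ] ∑[ x < k ] e x i
      ≡⟨ ∑-comm (λ i x → e x i) ⟩
    ∑[ x < k ] ∑[ i < m ] e x i
      ≤⟨ ∑-mono-≤ (λ x → sum≤sumTriples+2 (e x) (λ i → 𝟙≤1 (x ∈? w i))) ⟩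
    ∑[ x < k ] (sumTriples (λ i j l → e x i * (e x j * e x l)) + 2)
      ≡⟨ ∑-distrib-+ (λ x → sumTriples (λ i j l → e x i * (e x j * e x l))) (λ _ → 2) ⟩
    ∑[ x < k ] sumTriples (λ i j l → e x i * (e x j * e x l)) + ∑[ x < k ] 2
      ≡⟨ cong₂ _+_ (∑-sumTriples (λ x i j l → e x i * (e x j * e x l)))
                   (trans (∑-const k 2) (*-comm k 2)) ⟩
    sumTriples (λ i j l → ∣ w i ∩ w j ∩ w l ∣) + 2 * k
      ≤⟨ +-monoˡ-≤ (2 * k) triples≤ ⟩
    m * m * m * ∣ w i ∩ w j ∩ w l ∣ + 2 * k
      ≡⟨ +-comm _ (2 * k) ⟩
    2 * k + m * m * m * ∣ w i ∩ w j ∩ w l ∣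
      ∎)
    where
      open ≤-Reasoning
      e : Fin k → Fin m → ℕ
      e x i = 𝟙 (x ∈? w i)

toList≡tabulate-lookup : ∀ {a} {A : Set a} {n} (v : Vec A n) → toList v ≡ tabulate (lookup v)
toList≡tabulate-lookup []      = refl
toList≡tabulate-lookup (x ∷ v) = cong (x ∷_) (toList≡tabulate-lookup v)

toList-unique : ∀ {a} {A : Set a} {n} (v : Vec A n) →
                Injective _≡_ _≡_ (lookup v) → Unique (toList v)
toList-unique v lookup-injective =
  subst Unique (sym (toList≡tabulate-lookup v)) (tabulate⁺ lookup-injective)

lcs-rich-triple : ∀ {m k n} (π : Fin m → Vec (Fin k) n) →
  (∀ i → Injective _≡_ _≡_ (lookup (π i))) → 3 ≤ m →
  ∃[ i ] ∃[ j ] ∃[ l ] (i < j × j < l ×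
    m * n ≤ 2 * k + m * m * m * (LCS (toList (π i)) (toList (π j))
                                 * LCS (toList (π i)) (toList (π l))
                                 * LCS (toList (π j)) (toList (π l))))
lcs-rich-triple {m} {k} {n} π π-injective 3≤m
  with rich-triple (toList ∘ π) (λ i → toList-unique (π i) (π-injective i)) 3≤m
... | i , j , l , i<j , j<l , ∑≤ = i , j , l , i<j , j<l , (begin
  m * n                                    ≡⟨ ∑-const m n ⟨
  ∑[ i < m ] n                             ≡⟨ sum-cong-≗ (λ i → length-toList (π i)) ⟨
  ∑[ i < m ] length (w i)                  ≤⟨ ∑≤ ⟩
  2 * k + m * m * m * ∣ w i ∩ w j ∩ w l ∣
    ≤⟨ +-monoʳ-≤ (2 * k) (*-monoʳ-≤ (m * m * m) (∣∩∩∣≤LCS³ (w i) (w j) (w l))) ⟩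
  2 * k + m * m * m * (LCS (w i) (w j) * LCS (w i) (w l) * LCS (w j) (w l)) ∎)
  where
    open ≤-Reasoning
    w = toList ∘ π

m∸m%n≡[m/n]*n : ∀ m n .{{_ : NonZero n}} → m ∸ m % n ≡ (m / n) * n
m∸m%n≡[m/n]*n m n = trans (cong (_∸ m % n) (m≡m%n+[m/n]*n m n)) (m+n∸m≡n (m % n) _)

kOf≡lenOf*r² : ∀ r .{{_ : NonZero r}} → kOf r ≡ lenOf r * (r * r)
kOf≡lenOf*r² r = trans k≡q*r² (cong (_* (r * r)) (sym lenOf≡q))
  where
    instance
      r²≢0 : NonZero (r * r)
      r²≢0 = m*n≢0 r r
    k≡q*r² : kOf r ≡ (2 ^ r / (r * r)) * (r * r)
    k≡q*r² = m∸m%n≡[m/n]*n (2 ^ r) (r * r)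
    lenOf≡q : lenOf r ≡ 2 ^ r / (r * r)
    lenOf≡q = trans (cong (_/ (r * r)) k≡q*r²) (m*n/n≡m (2 ^ r / (r * r)) (r * r))

[2r²+r]³≤r⁷ : ∀ r .{{_ : NonZero r}} → 27 ≤ r →
              (2 * (r * r) + r) * (2 * (r * r) + r) * (2 * (r * r) + r) ≤ r ^ 7
[2r²+r]³≤r⁷ r 27≤r = begin
  m * m * m                                   ≤⟨ *-mono-≤ (*-mono-≤ m≤3r² m≤3r²) m≤3r² ⟩
  3 * (r * r) * (3 * (r * r)) * (3 * (r * r)) ≡⟨ expand r ⟩
  27 * r ^ 6                                  ≤⟨ *-monoˡ-≤ (r ^ 6) 27≤r ⟩
  r ^ 7                                       ∎
  where
    open ≤-Reasoning
    m = 2 * (r * r) + r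
    2r²+r²≡3r² : ∀ r → 2 * (r * r) + r * r ≡ 3 * (r * r)
    2r²+r²≡3r² = solve-∀
    m≤3r² : m ≤ 3 * (r * r)
    m≤3r² = subst (m ≤_) (2r²+r²≡3r² r) (+-monoʳ-≤ (2 * (r * r)) (m≤m*n r r))
    expand : ∀ r → 3 * (r * r) * (3 * (r * r)) * (3 * (r * r))
                 ≡ 27 * (r * (r * (r * (r * (r * (r * 1))))))
    expand = solve-∀

kOf≤r⁸* : ∀ {r} .{{_ : NonZero r}} → 27 ≤ r → ∀ L →
          (2 * (r * r) + r) * lenOf r
            ≤ 2 * kOf r + (2 * (r * r) + r) * (2 * (r * r) + r) * (2 * (r * r) + r) * L →
          kOf r ≤ r ^ 8 * L
kOf≤r⁸* {r} 27≤r L mn≤ = begin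
  kOf r            ≡⟨ kOf≡lenOf*r² r ⟩
  n * (r * r)      ≡⟨ n*r²≡r*[r*n] n r ⟩
  r * (r * n)      ≤⟨ *-monoʳ-≤ r (≤-trans rn≤m³L (*-monoˡ-≤ L ([2r²+r]³≤r⁷ r 27≤r))) ⟩
  r * (r ^ 7 * L)  ≡⟨ *-assoc r (r ^ 7) L ⟨
  r ^ 8 * L        ∎
  where
    open ≤-Reasoning
    n = lenOf r
    m = 2 * (r * r) + r
    n*r²≡r*[r*n] : ∀ n r → n * (r * r) ≡ r * (r * n)
    n*r²≡r*[r*n] = solve-∀
    m*n≡2k+rn : ∀ n r → (2 * (r * r) + r) * n ≡ 2 * (n * (r * r)) + r * n
    m*n≡2k+rn = solve-∀
    rn≤m³L : r * n ≤ m * m * m * L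
    rn≤m³L = +-cancelˡ-≤ (2 * kOf r) _ _ (subst (_≤ 2 * kOf r + m * m * m * L)
               (trans (m*n≡2k+rn n r) (cong (λ k → 2 * k + r * n) (sym (kOf≡lenOf*r² r)))) mn≤)

lemma8 : ∃[ r₀ ] ((r : ℕ) → .{{_ : NonZero r}} → r₀ ≤ r →
           (π : Fin (2 * (r * r) + r) → Vec (Fin (kOf r)) (lenOf r)) →
           ((i : Fin (2 * (r * r) + r)) → Injective _≡_ _≡_ (lookup (π i))) →
           ∃[ i ] ∃[ j ] ∃[ l ] (i < j × j < l ×
             kOf r ≤ r ^ 8 * (LCS (toList (π i)) (toList (π j))
                             * LCS (toList (π i)) (toList (π l))
                             * LCS (toList (π j)) (toList (π l)))))
lemma8 = 27 , λ r 27≤r π π-injective →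
  let i , j , l , i<j , j<l , bound = lcs-rich-triple π π-injective (3≤2r²+r 27≤r)
  in  i , j , l , i<j , j<l , kOf≤r⁸* 27≤r _ bound
  where
    3≤2r²+r : ∀ {r} → 27 ≤ r → 3 ≤ 2 * (r * r) + r
    3≤2r²+r {r} 27≤r = ≤-trans (s≤s (s≤s (s≤s z≤n))) (≤-trans 27≤r (m≤n+m r _))
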